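{- Let $p,q,r$ be positive integers and let $\mathbf d\in\mathbb Z^{p+q+r}$ be the all-$2$ vector. Then the Smith normal form of the integer matrix $D_X(K_{p,q,r})|_{X=\mathbf d}$ is $\operatorname{diag}(1,1,4,0,\dots,0)$.
   Context: For a connected graph $G$ with vertex set $V$, let $X=\{x_u: u\in V\}$ be indeterminates, $D(G)$ the distance matrix (entries $d_G(u,v)$), and $D_X(G)=\operatorname{diag}(X)+D(G)$ the generalized distance matrix; $D_X(G)|_{X=\mathbf d}$ denotes the integer matrix obtained by substituting $x_u=d_u$. $K_{p,q,r}$ is the complete tripartite graph with parts of sizes $p,q,r$. The Smith normal form of an integer matrix $M$ of rank $r$ is the unique diagonal matrix $\operatorname{diag}(f_1,\dots,f_r,0,\dots,0)$ equivalent to $M$ over $\mathbb Z$ with $f_i>0$, $f_i\mid f_{i+1}$. -}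

module Defs where

open import Data.Nat using (ℕ; zero; suc; _≤_; _<_; _≥_; _≤ᵇ_; _≡ᵇ_)
open import Data.Nat.Divisibility using (_∣_)
open import Data.Integer using (ℤ; +_; _+_; _*_; 0ℤ; 1ℤ)
open import Data.Fin using (Fin; toℕ; _≟_) renaming (zero to fz; suc to fs)
open import Data.Bool using (Bool; true; false; if_then_else_)
open import Data.Product using (Σ; _×_; _,_; ∃-syntax)
open import Relation.Nullary using (¬_; Dec; yes; no)
open import Relation.Binary.PropositionalEquality using (_≡_; _≢_)

Graph : ℕ → Set₁
Graph n = Fin n → Fin n → Set

data Walk {n : ℕ} (G : Graph n) : ℕ → Fin n → Fin n → Set where
  nil  : ∀ {u} → Walk G 0 u u
  cons : ∀ {k u w v} → G u w → Walk G k w v → Walk G (suc k) u v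

-- dist is the distance function of G: d(u,v) is the length of a
-- shortest u–v walk (G connected, so it exists for all u, v).
IsDistance : {n : ℕ} → Graph n → (Fin n → Fin n → ℕ) → Set
IsDistance {n} G dist =
  (u v : Fin n) → Walk G (dist u v) u v × ((k : ℕ) → Walk G k u v → dist u v ≤ k)

-- The complete tripartite graph K_{p,q,r} on Fin (p + q + r):
-- vertices 0..p-1 form part 0, p..p+q-1 part 1, the rest part 2.

part : ℕ → ℕ → ℕ → ℕ
part p q i = if suc i ≤ᵇ p then 0 else (if suc i ≤ᵇ p Data.Nat.+ q then 1 else 2)

K3 : (p q r : ℕ) → Graph (p Data.Nat.+ q Data.Nat.+ r)
K3 p q r u v = part p q (toℕ u) ≢ part p q (toℕ v)

Matrix : ℕ → ℕ → Set
Matrix m n = Fin m → Fin n → ℤ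

sumℤ : {n : ℕ} → (Fin n → ℤ) → ℤ
sumℤ {zero}  f = 0ℤ
sumℤ {suc n} f = f fz + sumℤ (λ i → f (fs i))

_⊗_ : {m n k : ℕ} → Matrix m n → Matrix n k → Matrix m k
(A ⊗ B) i j = sumℤ (λ l → A i l * B l j)

δ : {n : ℕ} → Fin n → Fin n → Bool
δ i j with i ≟ j
... | yes _ = true
... | no  _ = false

identity : (n : ℕ) → Matrix n n
identity n i j = if δ i j then 1ℤ else 0ℤ

Invertible : {n : ℕ} → Matrix n n → Set
Invertible {n} P = Σ (Matrix n n) λ Q →
  ((i j : Fin n) → (P ⊗ Q) i j ≡ identity n i j) ×
  ((i j : Fin n) → (Q ⊗ P) i j ≡ identity n i j)

Equivalent : {m n : ℕ} → Matrix m n → Matrix m n → Set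
Equivalent {m} {n} M N = Σ (Matrix m m) λ P → Σ (Matrix n n) λ Q →
  Invertible P × Invertible Q × ((i : Fin m) (j : Fin n) → ((P ⊗ M) ⊗ Q) i j ≡ N i j)

IsSmithForm : {n : ℕ} → Matrix n n → Set
IsSmithForm {n} S =
  ((i j : Fin n) → i ≢ j → S i j ≡ 0ℤ) ×
  Σ ℕ λ rk → (rk ≤ n) ×
    ((i : Fin n) → toℕ i < rk → Σ ℕ λ f → (S i i ≡ + (suc f))) ×
    ((i : Fin n) → rk ≤ toℕ i → S i i ≡ 0ℤ) ×
    ((i j : Fin n) → suc (toℕ i) ≡ toℕ j → toℕ j < rk →
       Data.Integer.∣ S i i ∣ ∣ Data.Integer.∣ S j j ∣)

SmithNormalFormOf : {n : ℕ} → Matrix n n → Matrix n n → Set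
SmithNormalFormOf M S = IsSmithForm S × Equivalent M S

DXat : {n : ℕ} → (dist : Fin n → Fin n → ℕ) → (x : Fin n → ℤ) → Matrix n n
DXat dist x i j = (if δ i j then x i else 0ℤ) + + (dist i j)

diag114 : (n : ℕ) → Matrix n n
diag114 n i j = if δ i j then val (toℕ i) else 0ℤ
  where
  val : ℕ → ℤ
  val 0 = + 1
  val 1 = + 1
  val 2 = + 4
  val _ = 0ℤ

-- With x = 2 the matrix D_X(K_{p,q,r}) has entry 2 between vertices of the
-- same part (the diagonal included, as d(u,u) = 0 and two distinct vertices
-- of one part are at distance 2) and 1 between different parts.  It is
-- therefore the pullback of the 3 × 3 matrix I + J along the map sending a
-- vertex to its part.  After relabelling so that the first three vertices
-- represent the three parts, every other row and column duplicates the row or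
-- column of its representative; subtracting those clears everything outside
-- the leading block, and I + J itself reduces to diag(1, 1, 4).

module Submission where

open import Defs
open import Data.Bool using (Bool; true; false; if_then_else_)
open import Data.Bool.Properties using (if-eta)
open import Data.Fin as Fin
  using (Fin; toℕ; fromℕ<; inject≤; splitAt; join; _↑ˡ_; _↑ʳ_)
  renaming (suc to fs)
open import Data.Fin.Patterns using (0F; 1F; 2F)
open import Data.Fin.Permutation
  using (Permutation; _⟨$⟩ʳ_; inverseˡ; inverseʳ; transpose; _∘ₚ_)
  renaming (flip to inverse)
open import Data.Fin.Properties
  using (toℕ-fromℕ<; toℕ-injective; toℕ-inject≤; toℕ-↑ˡ; ↑ˡ-injective; ↑ʳ-injective;
         splitAt-↑ˡ; splitAt-↑ʳ; splitAt-join; join-splitAt; punchInᵢ≢i; all?)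
open import Data.Integer as ℤ using (ℤ; +_; 0ℤ; 1ℤ; -1ℤ)
import Data.Integer.Properties as ℤ
open import Algebra.Properties.Semiring.Sum ℤ.+-*-semiring
  using (sum; sum-cong-≗; sum-replicate-zero; sum-remove; ∑-comm; ∑-distrib-+;
         *-distribˡ-sum; *-distribʳ-sum)
open import Data.Integer.Tactic.RingSolver using (solve-∀)
open import Data.Nat using (ℕ; zero; suc; _+_; _≤_; _<_; z≤n; s≤s; _≤ᵇ_)
import Data.Nat as ℕ
import Data.Nat.Properties as ℕ
open import Data.Nat.Divisibility using (1∣_; _∣_)
open import Data.Product using (Σ; _,_; proj₁; proj₂)
open import Data.Sum using (_⊎_; inj₁; inj₂; [_,_]′)
open import Data.Vec as Vec using (Vec; []; _∷_)
open import Function using (_∘_; const)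
open import Level using (0ℓ)
open import Relation.Binary.Bundles using (Setoid; Preorder)
open import Relation.Binary.Structures using (IsEquivalence)
open import Relation.Binary.PropositionalEquality
  using (_≡_; _≢_; ≢-sym; refl; sym; trans; cong; cong₂; subst; module ≡-Reasoning)
open import Relation.Nullary using (¬_; Dec; yes; no; contradiction)
open import Relation.Nullary.Decidable using (True; toWitness; dec-true; dec-false)
import Relation.Binary.Reasoning.Preorder as PreorderReasoning
import Relation.Binary.Reasoning.Setoid as SetoidReasoning

private
  variable
    k k′ k″ m m′ m″ n : ℕ

infix 4 _≈_
_≈_ : Matrix m n → Matrix m n → Set
A ≈ B = ∀ i j → A i j ≡ B i j

≈-isEquivalence : IsEquivalence (_≈_ {m} {n})
≈-isEquivalence = record
  { refl  = λ _ _ → refl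
  ; sym   = λ A≈B i j → sym (A≈B i j)
  ; trans = λ A≈B B≈C i j → trans (A≈B i j) (B≈C i j)
  }

≈-setoid : ℕ → ℕ → Setoid 0ℓ 0ℓ
≈-setoid m n = record { isEquivalence = ≈-isEquivalence {m} {n} }

module ≈-Reasoning {m n : ℕ} = SetoidReasoning (≈-setoid m n)

_≈?_ : (A B : Matrix m n) → Dec (A ≈ B)
A ≈? B = all? λ i → all? λ j → A i j ℤ.≟ B i j

≈-byComputation : {A B : Matrix m n} → True (A ≈? B) → A ≈ B
≈-byComputation = toWitness

infix 30 _ᵀ
_ᵀ : Matrix m n → Matrix n m
(A ᵀ) i j = A j i

zeroMatrix : Matrix m n
zeroMatrix _ _ = 0ℤ

δ-refl : (i : Fin n) → δ i i ≡ true
δ-refl i with i Fin.≟ i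
... | yes _   = refl
... | no i≢i = contradiction refl i≢i

δ-≢ : {i j : Fin n} → i ≢ j → δ i j ≡ false
δ-≢ {i = i} {j} i≢j with i Fin.≟ j
... | yes i≡j = contradiction i≡j i≢j
... | no _    = refl

δ-injective : (f : Fin m → Fin n) → (∀ {i j} → f i ≡ f j → i ≡ j) →
              ∀ i j → δ (f i) (f j) ≡ δ i j
δ-injective f f-injective i j with i Fin.≟ j
... | yes refl = δ-refl (f i)
... | no i≢j   = δ-≢ (i≢j ∘ f-injective)

identity-refl : (i : Fin n) → identity n i i ≡ 1ℤ
identity-refl i rewrite δ-refl i = refl

identity-≢ : {i j : Fin n} → i ≢ j → identity n i j ≡ 0ℤ
identity-≢ i≢j rewrite δ-≢ i≢j = refl

identity-sym : (i j : Fin n) → identity n i j ≡ identity n j i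
identity-sym i j = by-cases (i Fin.≟ j)
  where
  by-cases : Dec (i ≡ j) → identity _ i j ≡ identity _ j i
  by-cases (yes refl) = refl
  by-cases (no i≢j)   = trans (identity-≢ i≢j) (sym (identity-≢ (i≢j ∘ sym)))

sumℤ≡sum : (f : Fin n → ℤ) → sumℤ f ≡ sum f
sumℤ≡sum {zero}  f = refl
sumℤ≡sum {suc n} f = cong (ℤ._+_ (f 0F)) (sumℤ≡sum (f ∘ fs))

sumℤ-cong : {f g : Fin n → ℤ} → (∀ i → f i ≡ g i) → sumℤ f ≡ sumℤ g
sumℤ-cong {f = f} {g} f≗g = trans (sumℤ≡sum f) (trans (sum-cong-≗ f≗g) (sym (sumℤ≡sum g)))

sum-zero : {f : Fin n → ℤ} → (∀ i → f i ≡ 0ℤ) → sum f ≡ 0ℤ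
sum-zero {n} f≗0 = trans (sum-cong-≗ f≗0) (sum-replicate-zero n)

sum-single : (i : Fin n) {f : Fin n → ℤ} → (∀ j → j ≢ i → f j ≡ 0ℤ) → sum f ≡ f i
sum-single {suc n} i {f} f≗0 = begin
  sum f                            ≡⟨ sum-remove {i = i} f ⟩
  f i ℤ.+ sum (f ∘ Fin.punchIn i)  ≡⟨ cong (ℤ._+_ (f i)) (sum-zero λ j → f≗0 _ (punchInᵢ≢i i j)) ⟩
  f i ℤ.+ 0ℤ                       ≡⟨ ℤ.+-identityʳ (f i) ⟩
  f i                              ∎
  where open ≡-Reasoning

sum-splitAt : (k : ℕ) (f : Fin (k + m) → ℤ) →
              sum f ≡ sum (λ a → f (a ↑ˡ m)) ℤ.+ sum (λ b → f (k ↑ʳ b))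
sum-splitAt zero    f = sym (ℤ.+-identityˡ (sum f))
sum-splitAt (suc k) f =
  trans (cong (ℤ._+_ (f 0F)) (sum-splitAt k (f ∘ fs))) (sym (ℤ.+-assoc (f 0F) _ _))

⊗-sum : (A : Matrix m n) (B : Matrix n k) (i : Fin m) (j : Fin k) →
        (A ⊗ B) i j ≡ sum (λ l → A i l ℤ.* B l j)
⊗-sum A B i j = sumℤ≡sum (λ l → A i l ℤ.* B l j)

⊗-congˡ : (A : Matrix m n) {B B′ : Matrix n k} → B ≈ B′ → A ⊗ B ≈ A ⊗ B′
⊗-congˡ A B≈B′ i j = sumℤ-cong λ l → cong (ℤ._*_ (A i l)) (B≈B′ l j)

⊗-congʳ : (B : Matrix n k) {A A′ : Matrix m n} → A ≈ A′ → A ⊗ B ≈ A′ ⊗ B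
⊗-congʳ B A≈A′ i j = sumℤ-cong λ l → cong (λ x → x ℤ.* B l j) (A≈A′ i l)

⊗-identityˡ : (A : Matrix m n) → identity m ⊗ A ≈ A
⊗-identityˡ {m} A i j = begin
  (identity m ⊗ A) i j                  ≡⟨ ⊗-sum (identity m) A i j ⟩
  sum (λ l → identity m i l ℤ.* A l j)  ≡⟨ sum-single i off-diagonal ⟩
  identity m i i ℤ.* A i j              ≡⟨ cong (ℤ._* A i j) (identity-refl i) ⟩
  1ℤ ℤ.* A i j                          ≡⟨ ℤ.*-identityˡ (A i j) ⟩
  A i j                                 ∎
  where
  open ≡-Reasoning
  off-diagonal : ∀ l → l ≢ i → identity m i l ℤ.* A l j ≡ 0ℤ
  off-diagonal l l≢i = cong (ℤ._* A l j) (identity-≢ (l≢i ∘ sym))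

⊗-identityʳ : (A : Matrix m n) → A ⊗ identity n ≈ A
⊗-identityʳ {n = n} A i j = begin
  (A ⊗ identity n) i j                  ≡⟨ ⊗-sum A (identity n) i j ⟩
  sum (λ l → A i l ℤ.* identity n l j)  ≡⟨ sum-single j off-diagonal ⟩
  A i j ℤ.* identity n j j              ≡⟨ cong (A i j ℤ.*_) (identity-refl j) ⟩
  A i j ℤ.* 1ℤ                          ≡⟨ ℤ.*-identityʳ (A i j) ⟩
  A i j                                 ∎
  where
  open ≡-Reasoning
  off-diagonal : ∀ l → l ≢ j → A i l ℤ.* identity n l j ≡ 0ℤ
  off-diagonal l l≢j = trans (cong (A i l ℤ.*_) (identity-≢ l≢j)) (ℤ.*-zeroʳ (A i l))

⊗-assoc : (A : Matrix m n) (B : Matrix n k) (C : Matrix k k′) → (A ⊗ B) ⊗ C ≈ A ⊗ (B ⊗ C)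
⊗-assoc A B C i j = begin
  ((A ⊗ B) ⊗ C) i j
    ≡⟨ ⊗-sum (A ⊗ B) C i j ⟩
  sum (λ l → (A ⊗ B) i l ℤ.* C l j)
    ≡⟨ sum-cong-≗ (λ l → trans (cong (ℤ._* C l j) (⊗-sum A B i l))
                               (*-distribʳ-sum (C l j) (λ x → A i x ℤ.* B x l))) ⟩
  sum (λ l → sum (λ x → A i x ℤ.* B x l ℤ.* C l j))
    ≡⟨ ∑-comm (λ l x → A i x ℤ.* B x l ℤ.* C l j) ⟩
  sum (λ x → sum (λ l → A i x ℤ.* B x l ℤ.* C l j))
    ≡⟨ sum-cong-≗ (λ x → trans (sum-cong-≗ λ l → ℤ.*-assoc (A i x) (B x l) (C l j))
                               (sym (*-distribˡ-sum (A i x) (λ l → B x l ℤ.* C l j)))) ⟩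
  sum (λ x → A i x ℤ.* sum (λ l → B x l ℤ.* C l j))
    ≡⟨ sum-cong-≗ (λ x → cong (A i x ℤ.*_) (⊗-sum B C x j)) ⟨
  sum (λ x → A i x ℤ.* (B ⊗ C) x j)
    ≡⟨ ⊗-sum A (B ⊗ C) i j ⟨
  (A ⊗ (B ⊗ C)) i j
    ∎
  where open ≡-Reasoning

ᵀ-⊗ : (A : Matrix m n) (B : Matrix n k) → (A ⊗ B) ᵀ ≈ B ᵀ ⊗ A ᵀ
ᵀ-⊗ A B i j = sumℤ-cong λ l → ℤ.*-comm (A j l) (B l i)

⊗-inverse-⊗ : (A A′ B B′ : Matrix n n) → A ⊗ A′ ≈ identity n → B ⊗ B′ ≈ identity n →
              (A ⊗ B) ⊗ (B′ ⊗ A′) ≈ identity n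
⊗-inverse-⊗ A A′ B B′ AA′≈I BB′≈I = begin
  (A ⊗ B) ⊗ (B′ ⊗ A′)    ≈⟨ ⊗-assoc A B _ ⟩
  A ⊗ (B ⊗ (B′ ⊗ A′))    ≈⟨ ⊗-congˡ A (⊗-assoc B B′ A′) ⟨
  A ⊗ ((B ⊗ B′) ⊗ A′)    ≈⟨ ⊗-congˡ A (⊗-congʳ A′ BB′≈I) ⟩
  A ⊗ (identity _ ⊗ A′)  ≈⟨ ⊗-congˡ A (⊗-identityˡ A′) ⟩
  A ⊗ A′                 ≈⟨ AA′≈I ⟩
  identity _             ∎
  where open ≈-Reasoning

invertible-identity : Invertible (identity n)
invertible-identity = identity _ , ⊗-identityˡ _ , ⊗-identityˡ _

invertible-⊗ : {P Q : Matrix n n} → Invertible P → Invertible Q → Invertible (P ⊗ Q)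
invertible-⊗ {P = P} {Q} (P′ , PP′≈I , P′P≈I) (Q′ , QQ′≈I , Q′Q≈I) =
  Q′ ⊗ P′ , ⊗-inverse-⊗ P P′ Q Q′ PP′≈I QQ′≈I , ⊗-inverse-⊗ Q′ Q P′ P Q′Q≈I P′P≈I

invertible-ᵀ : {P : Matrix n n} → Invertible P → Invertible (P ᵀ)
invertible-ᵀ {P = P} (P′ , PP′≈I , P′P≈I) =
  P′ ᵀ , (λ i j → trans (sym (ᵀ-⊗ P′ P i j)) (trans (P′P≈I j i) (identity-sym j i)))
       , (λ i j → trans (sym (ᵀ-⊗ P P′ i j)) (trans (PP′≈I j i) (identity-sym j i)))

≈⇒Equivalent : {A B : Matrix n n} → A ≈ B → Equivalent A B
≈⇒Equivalent {A = A} A≈B =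
  identity _ , identity _ , invertible-identity , invertible-identity ,
  λ i j → trans (⊗-identityʳ (identity _ ⊗ A) i j) (trans (⊗-identityˡ A i j) (A≈B i j))

Equivalent-trans : {A B C : Matrix n n} → Equivalent A B → Equivalent B C → Equivalent A C
Equivalent-trans {A = A} {B} {C} (P , Q , P-inv , Q-inv , PAQ≈B) (P′ , Q′ , P′-inv , Q′-inv , P′BQ′≈C) =
  P′ ⊗ P , Q ⊗ Q′ , invertible-⊗ P′-inv P-inv , invertible-⊗ Q-inv Q′-inv , (begin
    ((P′ ⊗ P) ⊗ A) ⊗ (Q ⊗ Q′)  ≈⟨ ⊗-assoc ((P′ ⊗ P) ⊗ A) Q Q′ ⟨
    (((P′ ⊗ P) ⊗ A) ⊗ Q) ⊗ Q′  ≈⟨ ⊗-congʳ Q′ (⊗-congʳ Q (⊗-assoc P′ P A)) ⟩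
    ((P′ ⊗ (P ⊗ A)) ⊗ Q) ⊗ Q′  ≈⟨ ⊗-congʳ Q′ (⊗-assoc P′ (P ⊗ A) Q) ⟩
    (P′ ⊗ ((P ⊗ A) ⊗ Q)) ⊗ Q′  ≈⟨ ⊗-congʳ Q′ (⊗-congˡ P′ PAQ≈B) ⟩
    (P′ ⊗ B) ⊗ Q′              ≈⟨ P′BQ′≈C ⟩
    C                          ∎)
  where open ≈-Reasoning

Equivalent-preorder : ℕ → Preorder 0ℓ 0ℓ 0ℓ
Equivalent-preorder n = record
  { _≲_        = Equivalent
  ; isPreorder = record
    { isEquivalence = ≈-isEquivalence {n} {n}
    ; reflexive     = ≈⇒Equivalent
    ; trans         = Equivalent-trans
    }
  }

module Equivalent-Reasoning {n : ℕ} = PreorderReasoning (Equivalent-preorder n)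

transpose-matchˡ : (i j : Fin n) → transpose i j ⟨$⟩ʳ i ≡ j
transpose-matchˡ i j rewrite dec-true (i Fin.≟ i) refl = refl

transpose-fix : {i j k : Fin n} → k ≢ i → k ≢ j → transpose i j ⟨$⟩ʳ k ≡ k
transpose-fix {i = i} {j} {k} k≢i k≢j
  rewrite dec-false (k Fin.≟ i) k≢i | dec-false (k Fin.≟ j) k≢j = refl

rowPermutation : Permutation n n → Matrix n n
rowPermutation {n} τ i = identity n (τ ⟨$⟩ʳ i)

rowPermutation-⊗ : (τ : Permutation n n) (A : Matrix n m) →
                   rowPermutation τ ⊗ A ≈ λ i j → A (τ ⟨$⟩ʳ i) j
rowPermutation-⊗ τ A i = ⊗-identityˡ A (τ ⟨$⟩ʳ i)

invertible-rowPermutation : (τ : Permutation n n) → Invertible (rowPermutation τ)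
invertible-rowPermutation {n} τ = rowPermutation (inverse τ)
  , (λ i j → trans (rowPermutation-⊗ τ (rowPermutation (inverse τ)) i j)
                   (cong (λ k → identity n k j) (inverseˡ τ)))
  , (λ i j → trans (rowPermutation-⊗ (inverse τ) (rowPermutation τ) i j)
                   (cong (λ k → identity n k j) (inverseʳ τ)))

Equivalent-relabel : (τ : Permutation n n) (M : Matrix n n) →
                     Equivalent M (λ i j → M (τ ⟨$⟩ʳ i) (τ ⟨$⟩ʳ j))
Equivalent-relabel τ M = P , P ᵀ , P-inv , invertible-ᵀ P-inv , λ i j → begin
  ((P ⊗ M) ⊗ P ᵀ) i j      ≡⟨ ᵀ-⊗ P ((P ⊗ M) ᵀ) i j ⟨
  (P ⊗ (P ⊗ M) ᵀ) j i      ≡⟨ rowPermutation-⊗ τ ((P ⊗ M) ᵀ) j i ⟩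
  (P ⊗ M) i (τ ⟨$⟩ʳ j)     ≡⟨ rowPermutation-⊗ τ M i (τ ⟨$⟩ʳ j) ⟩
  M (τ ⟨$⟩ʳ i) (τ ⟨$⟩ʳ j)  ∎
  where
  open ≡-Reasoning
  P = rowPermutation τ
  P-inv = invertible-rowPermutation τ

-- Clearing duplicated rows and columns

module RowReduction {n : ℕ} (redundant : Fin n → Bool) (ρ : Fin n → Fin n)
                    (redundant-ρ : ∀ u → redundant (ρ u) ≡ false) where

  addRows : ℤ → Matrix n n
  addRows s u l =
    if redundant u then identity n u l ℤ.+ s ℤ.* identity n (ρ u) l else identity n u l

  zeroRows : Matrix n n → Matrix n n
  zeroRows A u j = if redundant u then 0ℤ else A u j

  zeroColumns : Matrix n n → Matrix n n
  zeroColumns A u j = if redundant j then 0ℤ else A u j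

  addRows-⊗-essential : ∀ s (A : Matrix n n) {u} j → redundant u ≡ false →
                        (addRows s ⊗ A) u j ≡ A u j
  addRows-⊗-essential s A {u} j u-essential = begin
    (addRows s ⊗ A) u j   ≡⟨ sumℤ-cong (λ l → cong (λ b → (if b then _ else _) ℤ.* A l j) u-essential) ⟩
    (identity n ⊗ A) u j  ≡⟨ ⊗-identityˡ A u j ⟩
    A u j                 ∎
    where open ≡-Reasoning

  addRows-⊗-redundant : ∀ s (A : Matrix n n) {u} j → redundant u ≡ true →
                        (addRows s ⊗ A) u j ≡ A u j ℤ.+ s ℤ.* A (ρ u) j
  addRows-⊗-redundant s A {u} j u-redundant = begin
    (addRows s ⊗ A) u j
      ≡⟨ ⊗-sum (addRows s) A u j ⟩
    sum (λ l → addRows s u l ℤ.* A l j)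
      ≡⟨ sum-cong-≗ (λ l → trans (cong (λ b → (if b then _ else _) ℤ.* A l j) u-redundant)
                                 (distribute (identity n u l) s (identity n (ρ u) l) (A l j))) ⟩
    sum (λ l → e u l ℤ.+ s ℤ.* e (ρ u) l)
      ≡⟨ ∑-distrib-+ (e u) (λ l → s ℤ.* e (ρ u) l) ⟩
    sum (e u) ℤ.+ sum (λ l → s ℤ.* e (ρ u) l)
      ≡⟨ cong (ℤ._+_ (sum (e u))) (*-distribˡ-sum s (e (ρ u))) ⟨
    sum (e u) ℤ.+ s ℤ.* sum (e (ρ u))
      ≡⟨ cong₂ (λ x y → x ℤ.+ s ℤ.* y) (⊗-sum (identity n) A u j) (⊗-sum (identity n) A (ρ u) j) ⟨
    (identity n ⊗ A) u j ℤ.+ s ℤ.* (identity n ⊗ A) (ρ u) j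
      ≡⟨ cong₂ (λ x y → x ℤ.+ s ℤ.* y) (⊗-identityˡ A u j) (⊗-identityˡ A (ρ u) j) ⟩
    A u j ℤ.+ s ℤ.* A (ρ u) j
      ∎
    where
    open ≡-Reasoning
    e : Fin n → Fin n → ℤ
    e v l = identity n v l ℤ.* A l j
    distribute : ∀ x t y a → (x ℤ.+ t ℤ.* y) ℤ.* a ≡ x ℤ.* a ℤ.+ t ℤ.* (y ℤ.* a)
    distribute = solve-∀

  addRows-cancel : ∀ s t → s ℤ.+ t ≡ 0ℤ → addRows s ⊗ addRows t ≈ identity n
  addRows-cancel s t s+t≡0 u l = by-cases (redundant u) refl
    where
    open ≡-Reasoning
    regroup : ∀ x t s y → (x ℤ.+ t ℤ.* y) ℤ.+ s ℤ.* y ≡ x ℤ.+ (s ℤ.+ t) ℤ.* y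
    regroup = solve-∀
    addRows-essential : ∀ {v} → redundant v ≡ false → addRows t v l ≡ identity n v l
    addRows-essential v-essential rewrite v-essential = refl
    by-cases : ∀ b → redundant u ≡ b → (addRows s ⊗ addRows t) u l ≡ identity n u l
    by-cases false u-essential =
      trans (addRows-⊗-essential s (addRows t) l u-essential) (addRows-essential u-essential)
    by-cases true u-redundant = begin
      (addRows s ⊗ addRows t) u l
        ≡⟨ addRows-⊗-redundant s (addRows t) l u-redundant ⟩
      addRows t u l ℤ.+ s ℤ.* addRows t (ρ u) l
        ≡⟨ cong₂ (λ x y → x ℤ.+ s ℤ.* y) (cong (λ b → if b then _ else _) u-redundant)
                                           (addRows-essential (redundant-ρ u)) ⟩
      (identity n u l ℤ.+ t ℤ.* identity n (ρ u) l) ℤ.+ s ℤ.* identity n (ρ u) l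
        ≡⟨ regroup (identity n u l) t s (identity n (ρ u) l) ⟩
      identity n u l ℤ.+ (s ℤ.+ t) ℤ.* identity n (ρ u) l
        ≡⟨ cong (λ c → identity n u l ℤ.+ c ℤ.* identity n (ρ u) l) s+t≡0 ⟩
      identity n u l ℤ.+ 0ℤ ℤ.* identity n (ρ u) l
        ≡⟨ ℤ.+-identityʳ (identity n u l) ⟩
      identity n u l
        ∎

  invertible-addRows : Invertible (addRows -1ℤ)
  invertible-addRows = addRows 1ℤ , addRows-cancel -1ℤ 1ℤ refl , addRows-cancel 1ℤ -1ℤ refl

  addRows-zeroRows : (A : Matrix n n) → (∀ u j → redundant u ≡ true → A u j ≡ A (ρ u) j) →
                     addRows -1ℤ ⊗ A ≈ zeroRows A
  addRows-zeroRows A duplicate u j = by-cases (redundant u) refl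
    where
    open ≡-Reasoning
    cancel : ∀ x → x ℤ.+ -1ℤ ℤ.* x ≡ 0ℤ
    cancel = solve-∀
    by-cases : ∀ b → redundant u ≡ b → (addRows -1ℤ ⊗ A) u j ≡ zeroRows A u j
    by-cases false u-essential = trans (addRows-⊗-essential -1ℤ A j u-essential)
                                       (cong (if_then 0ℤ else A u j) (sym u-essential))
    by-cases true u-redundant  = begin
      (addRows -1ℤ ⊗ A) u j        ≡⟨ addRows-⊗-redundant -1ℤ A j u-redundant ⟩
      A u j ℤ.+ -1ℤ ℤ.* A (ρ u) j  ≡⟨ cong (λ x → A u j ℤ.+ -1ℤ ℤ.* x) (duplicate u j u-redundant) ⟨
      A u j ℤ.+ -1ℤ ℤ.* A u j      ≡⟨ cancel (A u j) ⟩
      0ℤ                           ≡⟨ cong (if_then 0ℤ else A u j) u-redundant ⟨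
      zeroRows A u j               ∎

  ⊗-addRowsᵀ-zeroColumns : (A : Matrix n n) →
                           (∀ u j → redundant j ≡ true → A u j ≡ A u (ρ j)) →
                           A ⊗ addRows -1ℤ ᵀ ≈ zeroColumns A
  ⊗-addRowsᵀ-zeroColumns A duplicate i j =
    trans (sym (ᵀ-⊗ (addRows -1ℤ) (A ᵀ) i j))
          (addRows-zeroRows (A ᵀ) (λ u v → duplicate v u) j i)

  Equivalent-zeroRedundant : (M : Matrix n n) →
    (∀ u v → redundant u ≡ true → M u v ≡ M (ρ u) v) →
    (∀ u v → redundant v ≡ true → M u v ≡ M u (ρ v)) →
    Equivalent M (zeroColumns (zeroRows M))
  Equivalent-zeroRedundant M duplicateRows duplicateColumns =
    P , P ᵀ , invertible-addRows , invertible-ᵀ invertible-addRows , (begin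
      (P ⊗ M) ⊗ P ᵀ             ≈⟨ ⊗-congʳ (P ᵀ) (addRows-zeroRows M duplicateRows) ⟩
      zeroRows M ⊗ P ᵀ          ≈⟨ ⊗-addRowsᵀ-zeroColumns (zeroRows M) duplicateColumns′ ⟩
      zeroColumns (zeroRows M)  ∎)
    where
    open ≈-Reasoning
    P = addRows -1ℤ
    duplicateColumns′ : ∀ u v → redundant v ≡ true → zeroRows M u v ≡ zeroRows M u (ρ v)
    duplicateColumns′ u v v-redundant =
      cong (if redundant u then 0ℤ else_) (duplicateColumns u v v-redundant)

blockDiag : Matrix k k′ → Matrix m m′ → Fin k ⊎ Fin m → Fin k′ ⊎ Fin m′ → ℤ
blockDiag A B (inj₁ a) (inj₁ b) = A a b
blockDiag A B (inj₂ a) (inj₂ b) = B a b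
blockDiag A B _        _        = 0ℤ

infixl 25 _⊕_
_⊕_ : Matrix k k′ → Matrix m m′ → Matrix (k + m) (k′ + m′)
_⊕_ {k} {k′} A B i j = blockDiag A B (splitAt k i) (splitAt k′ j)

⊕-join : (A : Matrix k k′) (B : Matrix m m′) (s : Fin k ⊎ Fin m) (t : Fin k′ ⊎ Fin m′) →
         (A ⊕ B) (join k m s) (join k′ m′ t) ≡ blockDiag A B s t
⊕-join {k} {k′} {m} {m′} A B s t =
  cong₂ (blockDiag A B) (splitAt-join k m s) (splitAt-join k′ m′ t)

≈-⊕-blockwise : {X : Matrix (k + m) (k′ + m′)} {A : Matrix k k′} {B : Matrix m m′} →
                (∀ s t → X (join k m s) (join k′ m′ t) ≡ blockDiag A B s t) → X ≈ A ⊕ B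
≈-⊕-blockwise {k} {m} {k′} {m′} {X} X≡blocks i j =
  trans (sym (cong₂ X (join-splitAt k m i) (join-splitAt k′ m′ j)))
        (X≡blocks (splitAt k i) (splitAt k′ j))

⊕-cong : {A A′ : Matrix k k′} {B B′ : Matrix m m′} →
         A ≈ A′ → B ≈ B′ → A ⊕ B ≈ A′ ⊕ B′
⊕-cong {k} {k′} A≈A′ B≈B′ i j = blocks (splitAt k i) (splitAt k′ j)
  where
  blocks : ∀ s t → blockDiag _ _ s t ≡ blockDiag _ _ s t
  blocks (inj₁ a) (inj₁ b) = A≈A′ a b
  blocks (inj₁ a) (inj₂ b) = refl
  blocks (inj₂ a) (inj₁ b) = refl
  blocks (inj₂ a) (inj₂ b) = B≈B′ a b

blockDiag-⊗ : (A : Matrix k k′) (B : Matrix m m′) (C : Matrix k′ k″) (D : Matrix m′ m″) →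
              ∀ s t →
              sum (λ b → blockDiag A B s (inj₁ b) ℤ.* blockDiag C D (inj₁ b) t) ℤ.+
              sum (λ b → blockDiag A B s (inj₂ b) ℤ.* blockDiag C D (inj₂ b) t)
              ≡ blockDiag (A ⊗ C) (B ⊗ D) s t
blockDiag-⊗ {m′ = m′} A B C D (inj₁ a) (inj₁ c) =
  trans (cong₂ ℤ._+_ (sym (⊗-sum A C a c)) (sum-replicate-zero m′)) (ℤ.+-identityʳ _)
blockDiag-⊗ A B C D (inj₁ a) (inj₂ c) =
  cong₂ ℤ._+_ (sum-zero λ b → ℤ.*-zeroʳ (A a b)) (sum-zero λ b → ℤ.*-zeroˡ (D b c))
blockDiag-⊗ A B C D (inj₂ a) (inj₁ c) =
  cong₂ ℤ._+_ (sum-zero λ b → ℤ.*-zeroˡ (C b c)) (sum-zero λ b → ℤ.*-zeroʳ (B a b))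
blockDiag-⊗ {k′ = k′} A B C D (inj₂ a) (inj₂ c) =
  trans (cong₂ ℤ._+_ (sum-replicate-zero k′) (sym (⊗-sum B D a c))) (ℤ.+-identityˡ _)

⊕-⊗ : (A : Matrix k k′) (B : Matrix m m′) (C : Matrix k′ k″) (D : Matrix m′ m″) →
      (A ⊕ B) ⊗ (C ⊕ D) ≈ (A ⊗ C) ⊕ (B ⊗ D)
⊕-⊗ {k} {k′} {m} {m′} {k″} {m″} A B C D = ≈-⊕-blockwise λ s t → begin
  ((A ⊕ B) ⊗ (C ⊕ D)) (join k m s) (join k″ m″ t)
    ≡⟨ ⊗-sum (A ⊕ B) (C ⊕ D) (join k m s) (join k″ m″ t) ⟩
  sum (λ l → (A ⊕ B) (join k m s) l ℤ.* (C ⊕ D) l (join k″ m″ t))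
    ≡⟨ sum-splitAt k′ (λ l → (A ⊕ B) (join k m s) l ℤ.* (C ⊕ D) l (join k″ m″ t)) ⟩
  sum (λ b → (A ⊕ B) (join k m s) (b ↑ˡ m′) ℤ.* (C ⊕ D) (b ↑ˡ m′) (join k″ m″ t)) ℤ.+
  sum (λ b → (A ⊕ B) (join k m s) (k′ ↑ʳ b) ℤ.* (C ⊕ D) (k′ ↑ʳ b) (join k″ m″ t))
    ≡⟨ cong₂ ℤ._+_ (sum-cong-≗ λ b → cong₂ ℤ._*_ (⊕-join A B s (inj₁ b)) (⊕-join C D (inj₁ b) t))
                   (sum-cong-≗ λ b → cong₂ ℤ._*_ (⊕-join A B s (inj₂ b)) (⊕-join C D (inj₂ b) t)) ⟩
  sum (λ b → blockDiag A B s (inj₁ b) ℤ.* blockDiag C D (inj₁ b) t) ℤ.+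
  sum (λ b → blockDiag A B s (inj₂ b) ℤ.* blockDiag C D (inj₂ b) t)
    ≡⟨ blockDiag-⊗ A B C D s t ⟩
  blockDiag (A ⊗ C) (B ⊗ D) s t
    ∎
  where open ≡-Reasoning

identity-⊕ : identity (k + m) ≈ identity k ⊕ identity m
identity-⊕ {k} {m} = ≈-⊕-blockwise {A = identity k} {B = identity m} blocks
  where
  ↑ˡ≢↑ʳ : ∀ {a b} → a ↑ˡ m ≢ k ↑ʳ b
  ↑ˡ≢↑ʳ {a} {b} eq
    with () ← trans (sym (splitAt-↑ˡ k a m)) (trans (cong (splitAt k) eq) (splitAt-↑ʳ k m b))
  blocks : ∀ s t → identity (k + m) (join k m s) (join k m t) ≡ blockDiag (identity k) (identity m) s t
  blocks (inj₁ a) (inj₁ b) =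
    cong (if_then 1ℤ else 0ℤ) (δ-injective (_↑ˡ m) (↑ˡ-injective m _ _) a b)
  blocks (inj₁ a) (inj₂ b) = identity-≢ ↑ˡ≢↑ʳ
  blocks (inj₂ a) (inj₁ b) = identity-≢ (↑ˡ≢↑ʳ ∘ sym)
  blocks (inj₂ a) (inj₂ b) =
    cong (if_then 1ℤ else 0ℤ) (δ-injective (k ↑ʳ_) (↑ʳ-injective k _ _) a b)

invertible-⊕ : {P : Matrix k k} {Q : Matrix m m} →
               Invertible P → Invertible Q → Invertible (P ⊕ Q)
invertible-⊕ {k} {m} {P} {Q} (P′ , PP′≈I , P′P≈I) (Q′ , QQ′≈I , Q′Q≈I) =
  P′ ⊕ Q′ , inverse-⊕ P P′ Q Q′ PP′≈I QQ′≈I , inverse-⊕ P′ P Q′ Q P′P≈I Q′Q≈I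
  where
  inverse-⊕ : (A A′ : Matrix k k) (B B′ : Matrix m m) →
              A ⊗ A′ ≈ identity k → B ⊗ B′ ≈ identity m → (A ⊕ B) ⊗ (A′ ⊕ B′) ≈ identity (k + m)
  inverse-⊕ A A′ B B′ AA′≈I BB′≈I = begin
    (A ⊕ B) ⊗ (A′ ⊕ B′)      ≈⟨ ⊕-⊗ A B A′ B′ ⟩
    (A ⊗ A′) ⊕ (B ⊗ B′)      ≈⟨ ⊕-cong AA′≈I BB′≈I ⟩
    identity k ⊕ identity m  ≈⟨ identity-⊕ {k} {m} ⟨
    identity (k + m)         ∎
    where open ≈-Reasoning

Equivalent-⊕ : {A A′ : Matrix k k} {B B′ : Matrix m m} →
               Equivalent A A′ → Equivalent B B′ → Equivalent (A ⊕ B) (A′ ⊕ B′)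
Equivalent-⊕ {A = A} {A′} {B} {B′} (P , Q , P-inv , Q-inv , PAQ≈A′) (P′ , Q′ , P′-inv , Q′-inv , P′BQ′≈B′) =
  P ⊕ P′ , Q ⊕ Q′ , invertible-⊕ P-inv P′-inv , invertible-⊕ Q-inv Q′-inv , (begin
    ((P ⊕ P′) ⊗ (A ⊕ B)) ⊗ (Q ⊕ Q′)  ≈⟨ ⊗-congʳ (Q ⊕ Q′) (⊕-⊗ P P′ A B) ⟩
    ((P ⊗ A) ⊕ (P′ ⊗ B)) ⊗ (Q ⊕ Q′)  ≈⟨ ⊕-⊗ (P ⊗ A) (P′ ⊗ B) Q Q′ ⟩
    ((P ⊗ A) ⊗ Q) ⊕ ((P′ ⊗ B) ⊗ Q′)  ≈⟨ ⊕-cong PAQ≈A′ P′BQ′≈B′ ⟩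
    A′ ⊕ B′                          ∎)
  where open ≈-Reasoning

-- Pullbacks along a labelling of the indices

pullback : Matrix k k → (Fin n → Fin k) → Matrix n n
pullback C ℓ u v = C (ℓ u) (ℓ v)

Equivalent-pullback-⊕ : (C : Matrix k k) (ℓ : Fin (k + m) → Fin k) → (∀ a → ℓ (a ↑ˡ m) ≡ a) →
                        Equivalent (pullback C ℓ) (C ⊕ zeroMatrix {m})
Equivalent-pullback-⊕ {k} {m} C ℓ ℓ-section =
  Equivalent-trans (Equivalent-zeroRedundant (pullback C ℓ) duplicateRows duplicateColumns)
                   (≈⇒Equivalent (≈-⊕-blockwise blocks))
  where
  inSecondBlock : Fin k ⊎ Fin m → Bool
  inSecondBlock = [ const false , const true ]′
  open RowReduction (inSecondBlock ∘ splitAt k) (λ u → ℓ u ↑ˡ m)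
                    (λ u → cong inSecondBlock (splitAt-↑ˡ k (ℓ u) m))
  duplicateRows : ∀ u v → inSecondBlock (splitAt k u) ≡ true →
                  pullback C ℓ u v ≡ pullback C ℓ (ℓ u ↑ˡ m) v
  duplicateRows u v _ = cong (λ a → C a (ℓ v)) (sym (ℓ-section (ℓ u)))
  duplicateColumns : ∀ u v → inSecondBlock (splitAt k v) ≡ true →
                     pullback C ℓ u v ≡ pullback C ℓ u (ℓ v ↑ˡ m)
  duplicateColumns u v _ = cong (C (ℓ u)) (sym (ℓ-section (ℓ v)))
  blocks : ∀ s t → zeroColumns (zeroRows (pullback C ℓ)) (join k m s) (join k m t)
                   ≡ blockDiag C zeroMatrix s t
  blocks (inj₁ a) (inj₁ b) rewrite splitAt-↑ˡ k a m | splitAt-↑ˡ k b m =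
    cong₂ C (ℓ-section a) (ℓ-section b)
  blocks (inj₁ a) (inj₂ b) rewrite splitAt-↑ʳ k m b = refl
  blocks (inj₂ a) (inj₁ b) rewrite splitAt-↑ˡ k b m | splitAt-↑ʳ k m a = refl
  blocks (inj₂ a) (inj₂ b) rewrite splitAt-↑ʳ k m b = refl

-- The matrix I + J and diag(1, 1, 4)

identityPlusOnes : (k : ℕ) → Matrix k k
identityPlusOnes k a b = if δ a b then + 2 else + 1

matrix₃ : Vec (Vec ℤ 3) 3 → Matrix 3 3
matrix₃ rows i j = Vec.lookup (Vec.lookup rows i) j

-- U replaces the last row of I + J by the row sum (4, 4, 4); V then subtracts
-- the last column from the other two and replaces it by 3 c₃ − c₁ − c₂.
Equivalent-identityPlusOnes₃ : Equivalent (identityPlusOnes 3) (diag114 3)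
Equivalent-identityPlusOnes₃ =
  U , V , (U⁻¹ , ≈-byComputation _ , ≈-byComputation _)
        , (V⁻¹ , ≈-byComputation _ , ≈-byComputation _)
        , ≈-byComputation _
  where
  U U⁻¹ V V⁻¹ : Matrix 3 3
  U   = matrix₃ ((+ 1 ∷ + 0 ∷ + 0 ∷ []) ∷ (+ 0 ∷ + 1 ∷ + 0 ∷ []) ∷ (+ 1 ∷ + 1 ∷ + 1 ∷ []) ∷ [])
  U⁻¹ = matrix₃ ((+ 1 ∷ + 0 ∷ + 0 ∷ []) ∷ (+ 0 ∷ + 1 ∷ + 0 ∷ []) ∷ (-1ℤ ∷ -1ℤ ∷ + 1 ∷ []) ∷ [])
  V   = matrix₃ ((+ 1 ∷ + 0 ∷ -1ℤ ∷ []) ∷ (+ 0 ∷ + 1 ∷ -1ℤ ∷ []) ∷ (-1ℤ ∷ -1ℤ ∷ + 3 ∷ []) ∷ [])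
  V⁻¹ = matrix₃ ((+ 2 ∷ + 1 ∷ + 1 ∷ []) ∷ (+ 1 ∷ + 2 ∷ + 1 ∷ []) ∷ (+ 1 ∷ + 1 ∷ + 1 ∷ []) ∷ [])

diag114-⊕ : diag114 3 ⊕ zeroMatrix {m} ≈ diag114 (3 + m)
diag114-⊕ 0F               0F               = refl
diag114-⊕ 0F               1F               = refl
diag114-⊕ 0F               2F               = refl
diag114-⊕ 0F               (fs (fs (fs j))) = refl
diag114-⊕ 1F               0F               = refl
diag114-⊕ 1F               1F               = refl
diag114-⊕ 1F               2F               = refl
diag114-⊕ 1F               (fs (fs (fs j))) = refl
diag114-⊕ 2F               0F               = refl
diag114-⊕ 2F               1F               = refl
diag114-⊕ 2F               2F               = refl
diag114-⊕ 2F               (fs (fs (fs j))) = refl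
diag114-⊕ (fs (fs (fs i))) 0F               = refl
diag114-⊕ (fs (fs (fs i))) 1F               = refl
diag114-⊕ (fs (fs (fs i))) 2F               = refl
diag114-⊕ (fs (fs (fs i))) (fs (fs (fs j))) = sym (if-eta (δ (fs (fs (fs i))) (fs (fs (fs j)))))

diag114-isSmithForm : 3 ≤ n → IsSmithForm (diag114 n)
diag114-isSmithForm {n} 3≤n = offDiagonal , 3 , 3≤n , positive , vanishing , divides
  where
  offDiagonal : ∀ i j → i ≢ j → diag114 n i j ≡ 0ℤ
  offDiagonal i j i≢j rewrite δ-≢ i≢j = refl
  positive : ∀ i → toℕ i < 3 → Σ ℕ λ f → diag114 n i i ≡ + suc f
  positive i i<3 rewrite δ-refl i with toℕ i | i<3
  ... | 0                 | _ = 0 , refl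
  ... | 1                 | _ = 0 , refl
  ... | 2                 | _ = 3 , refl
  ... | suc (suc (suc _)) | s≤s (s≤s (s≤s ()))
  vanishing : ∀ i → 3 ≤ toℕ i → diag114 n i i ≡ 0ℤ
  vanishing i 3≤i rewrite δ-refl i with toℕ i | 3≤i
  ... | 0                 | ()
  ... | 1                 | s≤s ()
  ... | 2                 | s≤s (s≤s ())
  ... | suc (suc (suc _)) | _ = refl
  divides : ∀ i j → suc (toℕ i) ≡ toℕ j → toℕ j < 3 →
            ℤ.∣ diag114 n i i ∣ ∣ ℤ.∣ diag114 n j j ∣
  divides i j i+1≡j j<3 rewrite δ-refl i with toℕ i | i+1≡j
  ... | 0           | _     = 1∣ _
  ... | 1           | _     = 1∣ _
  ... | suc (suc _) | i+1≡j =
    contradiction (subst (_< 3) (sym i+1≡j) j<3) λ { (s≤s (s≤s (s≤s ()))) }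

Equivalent-pullback-identityPlusOnes₃ :
  (3≤n : 3 ≤ n) (ℓ : Fin n → Fin 3) → (∀ a → ℓ (inject≤ a 3≤n) ≡ a) →
  Equivalent (pullback (identityPlusOnes 3) ℓ) (diag114 n)
Equivalent-pullback-identityPlusOnes₃ {suc (suc (suc m))} 3≤n@(s≤s (s≤s (s≤s z≤n))) ℓ ℓ-section =
  begin
    pullback (identityPlusOnes 3) ℓ      ≲⟨ Equivalent-pullback-⊕ (identityPlusOnes 3) ℓ ℓ-section′ ⟩
    identityPlusOnes 3 ⊕ zeroMatrix {m}  ≲⟨ Equivalent-⊕ {A = identityPlusOnes 3} {diag114 3} {zeroMatrix}
                                                          Equivalent-identityPlusOnes₃ (≈⇒Equivalent λ _ _ → refl) ⟩
    diag114 3 ⊕ zeroMatrix {m}           ≈⟨ diag114-⊕ {m} ⟩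
    diag114 (3 + m)                      ∎
  where
  open Equivalent-Reasoning {3 + m}
  ℓ-section′ : ∀ a → ℓ (a ↑ˡ m) ≡ a
  ℓ-section′ a =
    trans (cong ℓ (toℕ-injective (trans (toℕ-↑ˡ a m) (sym (toℕ-inject≤ a 3≤n))))) (ℓ-section a)

module _ {G : Graph n} {dist : Fin n → Fin n → ℕ} (isDistance : IsDistance G dist) where

  dist-refl : ∀ u → dist u u ≡ 0
  dist-refl u = ℕ.n≤0⇒n≡0 (proj₂ (isDistance u u) 0 nil)

  dist-adjacent : ∀ {u v} → u ≢ v → G u v → dist u v ≡ 1
  dist-adjacent {u} {v} u≢v uv
    with dist u v | proj₁ (isDistance u v) | proj₂ (isDistance u v) 1 (cons uv nil)
  ... | 0           | nil | _      = contradiction refl u≢v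
  ... | 1           | _   | _      = refl
  ... | suc (suc _) | _   | s≤s ()

  dist-commonNeighbour : ∀ {u v w} → u ≢ v → ¬ G u v → G u w → G w v → dist u v ≡ 2
  dist-commonNeighbour {u} {v} u≢v ¬uv uw wv
    with dist u v | proj₁ (isDistance u v) | proj₂ (isDistance u v) 2 (cons uw (cons wv nil))
  ... | 0                 | nil         | _            = contradiction refl u≢v
  ... | 1                 | cons uv nil | _            = contradiction uv ¬uv
  ... | 2                 | _           | _            = refl
  ... | suc (suc (suc _)) | _           | s≤s (s≤s ())

-- The complete tripartite graph

≤ᵇ-true : ∀ {m n} → m ≤ n → (m ≤ᵇ n) ≡ true
≤ᵇ-true {m} {n} = dec-true (m ℕ.≤? n)

≤ᵇ-false : ∀ {m n} → ¬ m ≤ n → (m ≤ᵇ n) ≡ false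
≤ᵇ-false {m} {n} = dec-false (m ℕ.≤? n)

module _ {p q : ℕ} where

  part-< : ∀ {i} → i < p → part p q i ≡ 0
  part-< i<p rewrite ≤ᵇ-true i<p = refl

  part-middle : ∀ {i} → p ≤ i → i < p + q → part p q i ≡ 1
  part-middle p≤i i<p+q rewrite ≤ᵇ-false (ℕ.≤⇒≯ p≤i) | ≤ᵇ-true i<p+q = refl

  part-≥ : ∀ {i} → p + q ≤ i → part p q i ≡ 2
  part-≥ p+q≤i
    rewrite ≤ᵇ-false (ℕ.≤⇒≯ (ℕ.≤-trans (ℕ.m≤m+n p q) p+q≤i)) | ≤ᵇ-false (ℕ.≤⇒≯ p+q≤i) = refl

  part<3 : ∀ i → part p q i < 3
  part<3 i with suc i ≤ᵇ p | suc i ≤ᵇ p + q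
  ... | true  | _     = s≤s z≤n
  ... | false | true  = s≤s (s≤s z≤n)
  ... | false | false = s≤s (s≤s (s≤s z≤n))

module Tripartite (p q r : ℕ) (1≤p : 1 ≤ p) (1≤q : 1 ≤ q) (1≤r : 1 ≤ r) where

  3≤n : 3 ≤ p + q + r
  3≤n = ℕ.+-mono-≤ (ℕ.+-mono-≤ 1≤p 1≤q) 1≤r

  partOf : Fin (p + q + r) → Fin 3
  partOf u = fromℕ< (part<3 {p} {q} (toℕ u))

  toℕ-partOf : ∀ u → toℕ (partOf u) ≡ part p q (toℕ u)
  toℕ-partOf u = toℕ-fromℕ< _

  differentParts⇒adjacent : ∀ {u v} → partOf u ≢ partOf v → K3 p q r u v
  differentParts⇒adjacent {u} {v} u≁v same =
    u≁v (toℕ-injective (trans (toℕ-partOf u) (trans same (sym (toℕ-partOf v)))))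

  adjacent⇒differentParts : ∀ {u v} → K3 p q r u v → partOf u ≢ partOf v
  adjacent⇒differentParts {u} {v} uv same =
    uv (trans (sym (toℕ-partOf u)) (trans (cong toℕ same) (toℕ-partOf v)))

  p<p+q : p < p + q
  p<p+q = ℕ.m<m+n p 1≤q

  0<p+q : 0 < p + q
  0<p+q = ℕ.<-trans 1≤p p<p+q

  1<p+q : 1 < p + q
  1<p+q = ℕ.+-mono-≤ 1≤p 1≤q

  p+q<n : p + q < p + q + r
  p+q<n = ℕ.m<m+n (p + q) 1≤r

  firstVertex : Fin 3 → ℕ
  firstVertex 0F = 0
  firstVertex 1F = p
  firstVertex 2F = p + q

  firstVertex<n : ∀ a → firstVertex a < p + q + r
  firstVertex<n 0F = ℕ.<-trans 0<p+q p+q<n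
  firstVertex<n 1F = ℕ.<-trans p<p+q p+q<n
  firstVertex<n 2F = p+q<n

  part-firstVertex : ∀ a → part p q (firstVertex a) ≡ toℕ a
  part-firstVertex 0F = part-< 1≤p
  part-firstVertex 1F = part-middle ℕ.≤-refl p<p+q
  part-firstVertex 2F = part-≥ {p} {q} ℕ.≤-refl

  representative : Fin 3 → Fin (p + q + r)
  representative a = fromℕ< (firstVertex<n a)

  toℕ-representative : ∀ a → toℕ (representative a) ≡ firstVertex a
  toℕ-representative a = toℕ-fromℕ< (firstVertex<n a)

  partOf-representative : ∀ a → partOf (representative a) ≡ a
  partOf-representative a = toℕ-injective (begin
    toℕ (partOf (representative a))    ≡⟨ toℕ-partOf (representative a) ⟩
    part p q (toℕ (representative a))  ≡⟨ cong (part p q) (toℕ-representative a) ⟩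
    part p q (firstVertex a)           ≡⟨ part-firstVertex a ⟩
    toℕ a                              ∎)
    where open ≡-Reasoning

  otherPart : Fin 3 → Fin 3
  otherPart 0F     = 1F
  otherPart (fs _) = 0F

  otherPart-≢ : ∀ a → otherPart a ≢ a
  otherPart-≢ 0F     ()
  otherPart-≢ (fs _) ()

  module _ {dist : Fin (p + q + r) → Fin (p + q + r) → ℕ} (isDistance : IsDistance (K3 p q r) dist) where

    dist-samePart : ∀ {u v} → u ≢ v → partOf u ≡ partOf v → dist u v ≡ 2
    dist-samePart {u} {v} u≢v same = dist-commonNeighbour isDistance u≢v
      (λ uv → adjacent⇒differentParts uv same)
      (differentParts⇒adjacent λ e → w-elsewhere (sym e))
      (differentParts⇒adjacent λ e → w-elsewhere (trans e (sym same)))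
      where
      w = representative (otherPart (partOf u))
      w-elsewhere : partOf w ≢ partOf u
      w-elsewhere e = otherPart-≢ (partOf u) (trans (sym (partOf-representative _)) e)

    DXat≈pullback : DXat dist (λ _ → + 2) ≈ pullback (identityPlusOnes 3) partOf
    DXat≈pullback u v = by-cases (u Fin.≟ v) (partOf u Fin.≟ partOf v)
      where
      by-cases : Dec (u ≡ v) → Dec (partOf u ≡ partOf v) →
                 DXat dist (λ _ → + 2) u v ≡ identityPlusOnes 3 (partOf u) (partOf v)
      by-cases (yes refl) _
        rewrite δ-refl u | δ-refl (partOf u) | dist-refl isDistance u = refl
      by-cases (no u≢v) (yes same)
        rewrite δ-≢ u≢v | same | δ-refl (partOf v) | dist-samePart u≢v same = refl
      by-cases (no u≢v) (no different)
        rewrite δ-≢ u≢v | δ-≢ different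
              | dist-adjacent isDistance u≢v (differentParts⇒adjacent different) = refl

  vertex : Fin 3 → Fin (p + q + r)
  vertex a = inject≤ a 3≤n

  toℕ-vertex : ∀ a → toℕ (vertex a) ≡ toℕ a
  toℕ-vertex a = toℕ-inject≤ a 3≤n

  distinct : ∀ {i j : Fin (p + q + r)} {x y} → toℕ i ≡ x → toℕ j ≡ y → x ≢ y → i ≢ j
  distinct i≡x j≡y x≢y i≡j = x≢y (trans (sym i≡x) (trans (cong toℕ i≡j) j≡y))

  swap₁ swap₂ relabel : Permutation (p + q + r) (p + q + r)
  swap₁   = transpose (vertex 1F) (representative 1F)
  swap₂   = transpose (vertex 2F) (representative 2F)
  relabel = swap₂ ∘ₚ swap₁

  relabel-vertex : ∀ a → relabel ⟨$⟩ʳ vertex a ≡ representative a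
  relabel-vertex 0F = begin
    swap₁ ⟨$⟩ʳ (swap₂ ⟨$⟩ʳ vertex 0F)  ≡⟨ cong (swap₁ ⟨$⟩ʳ_) (transpose-fix 0≢2 0≢p+q) ⟩
    swap₁ ⟨$⟩ʳ vertex 0F               ≡⟨ transpose-fix 0≢1 0≢p ⟩
    vertex 0F                          ≡⟨ toℕ-injective (trans (toℕ-vertex 0F)
                                                                (sym (toℕ-representative 0F))) ⟩
    representative 0F                  ∎
    where
    open ≡-Reasoning
    0≢2   = distinct (toℕ-vertex 0F) (toℕ-vertex 2F) λ ()
    0≢p+q = distinct (toℕ-vertex 0F) (toℕ-representative 2F) (ℕ.<⇒≢ 0<p+q)
    0≢1   = distinct (toℕ-vertex 0F) (toℕ-vertex 1F) λ ()
    0≢p   = distinct (toℕ-vertex 0F) (toℕ-representative 1F) (ℕ.<⇒≢ 1≤p)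
  relabel-vertex 1F = begin
    swap₁ ⟨$⟩ʳ (swap₂ ⟨$⟩ʳ vertex 1F)  ≡⟨ cong (swap₁ ⟨$⟩ʳ_) (transpose-fix 1≢2 1≢p+q) ⟩
    swap₁ ⟨$⟩ʳ vertex 1F               ≡⟨ transpose-matchˡ (vertex 1F) (representative 1F) ⟩
    representative 1F                  ∎
    where
    open ≡-Reasoning
    1≢2   = distinct (toℕ-vertex 1F) (toℕ-vertex 2F) λ ()
    1≢p+q = distinct (toℕ-vertex 1F) (toℕ-representative 2F) (ℕ.<⇒≢ 1<p+q)
  relabel-vertex 2F = begin
    swap₁ ⟨$⟩ʳ (swap₂ ⟨$⟩ʳ vertex 2F)  ≡⟨ cong (swap₁ ⟨$⟩ʳ_)
                                             (transpose-matchˡ (vertex 2F) (representative 2F)) ⟩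
    swap₁ ⟨$⟩ʳ representative 2F       ≡⟨ transpose-fix p+q≢1 p+q≢p ⟩
    representative 2F                  ∎
    where
    open ≡-Reasoning
    p+q≢1 = distinct (toℕ-representative 2F) (toℕ-vertex 1F) (≢-sym (ℕ.<⇒≢ 1<p+q))
    p+q≢p = distinct (toℕ-representative 2F) (toℕ-representative 1F) (≢-sym (ℕ.<⇒≢ p<p+q))

  partOf-relabel : ∀ a → partOf (relabel ⟨$⟩ʳ vertex a) ≡ a
  partOf-relabel a = trans (cong partOf (relabel-vertex a)) (partOf-representative a)

mainTheorem8 : (p q r : ℕ) → 1 ≤ p → 1 ≤ q → 1 ≤ r →
    (dist : Fin (p + q + r) → Fin (p + q + r) → ℕ) → IsDistance (K3 p q r) dist →
    SmithNormalFormOf (DXat dist (λ _ → + 2)) (diag114 (p + q + r))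
mainTheorem8 p q r 1≤p 1≤q 1≤r dist isDistance = diag114-isSmithForm 3≤n , (begin
  DXat dist (λ _ → + 2)                                     ≈⟨ DXat≈pullback isDistance ⟩
  pullback (identityPlusOnes 3) partOf                      ≲⟨ Equivalent-relabel relabel _ ⟩
  pullback (identityPlusOnes 3) (partOf ∘ (relabel ⟨$⟩ʳ_))  ≲⟨ Equivalent-pullback-identityPlusOnes₃
                                                                  3≤n _ partOf-relabel ⟩
  diag114 (p + q + r)                                       ∎)
  where
  open Tripartite p q r 1≤p 1≤q 1≤r
  open Equivalent-Reasoning {p + q + r}
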